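{- Let $\lambda$ be a partition of $n$ with conjugate $\lambda'$. Let $B_\lambda\times 1$ be the Ferrers board obtained from $B_\lambda$ by increasing the height of every column by one. Then the complement of $B_\lambda\times 1$ in the $n\times n$ array $[n]\times[n]$ is, up to rotation, the Ferrers board $B_{\lambda'}$.
   Context: A board is a subset of the $n\times n$ array of squares $[n]\times[n]$, whose squares are indexed $(i,j)$ with $i$ the column (left to right) and $j$ the row (bottom to top). A Ferrers board is a board consisting of bottom-justified columns whose heights weakly increase from left to right. The content of a box $u=(i,j)$ in the diagram of a partition (box in column $i$, row $j$, rows counted from the bottom, $\lambda_j$ boxes in row $j$, left justified) is $c(u)=i-j$. For a partition $\lambda$ of $n$, list the contents of its $n$ boxes in weakly decreasing order $c_1\ge c_2\ge\cdots\ge c_n$; $B_\lambda$ is the Ferrers board whose $i$-th column (from the left) has height $c_i+i-1$. -}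

module Defs where

open import Data.Nat using (ℕ; zero; suc; _≤_; _≥_; _<_; _≤?_)
open import Data.Integer as ℤ using (ℤ; +_; _-_)
import Data.Integer.Properties as ℤP
open import Data.List using (List; []; _∷_; map; concat; length; filter; upTo; reverse; drop)
open import Data.Nat.ListAction using (sum)
open import Data.List.Relation.Unary.All using (All)
open import Data.List.Relation.Unary.Linked using (Linked)
open import Data.Fin using (Fin; toℕ; opposite)
open import Data.Product using (_×_; _,_)
open import Relation.Binary.PropositionalEquality using (_≡_)
open import Relation.Nullary using (¬_)
import Data.List.Sort ℤP.≤-decTotalOrder as ZSort

-- Partitions: weakly decreasing lists of positive naturals summing to n.
-- parts = (λ₁, λ₂, …), λ_j = number of boxes in row j (rows from bottom).

record Partition (n : ℕ) : Set where
  field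
    parts    : List ℕ
    weaklyDecreasing : Linked _≥_ parts
    positive : All (λ k → 1 ≤ k) parts
    sumIsN   : sum parts ≡ n

open Partition public

head0 : List ℕ → ℕ
head0 []      = 0
head0 (x ∷ _) = x

conjugateParts : List ℕ → List ℕ
conjugateParts l = map (λ k → length (filter (λ m → suc k ≤? m) l)) (upTo (head0 l))

-- contents of the boxes: box in column i, row j (both 1-indexed) has content i - j
contentsFrom : ℕ → List ℕ → List ℤ
contentsFrom j []       = []
contentsFrom j (r ∷ rs) =
  map (λ i → + suc i - + j) (upTo r) Data.List.++ contentsFrom (suc j) rs

contents : List ℕ → List ℤ
contents l = contentsFrom 1 l

sortedContents : List ℕ → List ℤ
sortedContents l = reverse (ZSort.sort (contents l))

-- k-th element (0-indexed), default 0 if out of range (never used for k < n)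
nth : List ℤ → ℕ → ℤ
nth []       _       = + 0
nth (x ∷ _)  zero    = x
nth (_ ∷ xs) (suc k) = nth xs k

-- Boards in the n × n array: squares are (i , j) : Fin n × Fin n, with
-- column number toℕ i + 1 and row number toℕ j + 1 (rows from the bottom).

Board : ℕ → Set₁
Board n = Fin n → Fin n → Set

ferrersBoard : (n : ℕ) → (ℕ → ℤ) → Board n
ferrersBoard n h i j = + suc (toℕ j) ℤ.≤ h (suc (toℕ i))

heightB : List ℕ → ℕ → ℤ
heightB l zero    = + 0
heightB l (suc k) = nth (sortedContents l) k ℤ.+ + k

B : {n : ℕ} → Partition n → Board n
B {n} lam = ferrersBoard n (heightB (parts lam))

B×1 : {n : ℕ} → Partition n → Board n
B×1 {n} lam = ferrersBoard n (λ i → heightB (parts lam) i ℤ.+ + 1)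

Bconj : {n : ℕ} → Partition n → Board n
Bconj {n} lam = ferrersBoard n (heightB (conjugateParts (parts lam)))

complement : {n : ℕ} → Board n → Board n
complement P i j = ¬ P i j

data Rotation : Set where
  rot0 rot90 rot180 rot270 : Rotation

rotate : {n : ℕ} → Rotation → Fin n × Fin n → Fin n × Fin n
rotate rot0   (i , j) = (i , j)
rotate rot90  (i , j) = (opposite j , i)
rotate rot180 (i , j) = (opposite i , opposite j)
rotate rot270 (i , j) = (j , opposite i)

rotatedBoard : {n : ℕ} → Rotation → Board n → Board n
rotatedBoard r P i j = P′ (rotate r (i , j))
  where
    P′ : _ → Set
    P′ (a , b) = P a b

_≅rot_ : {n : ℕ} → Board n → Board n → Set
_≅rot_ {n} P Q = Data.Product.Σ Rotation λ r →
  (∀ i j → P i j → Q′ (rotate r (i , j))) × (∀ i j → Q′ (rotate r (i , j)) → P i j)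
  where
    Q′ : Fin n × Fin n → Set
    Q′ (a , b) = Q a b

-- Transposing the Young diagram negates every content, so the contents of λ′
-- sorted decreasingly are c′ₖ = - c_{n+1-k}.  Hence the column heights satisfy
-- (c_i + i - 1) + 1 + (c′_{n+1-i} + n - i) = n: column i of B_λ × 1 and column
-- n+1-i of B_λ′ together fill a column of the n × n array exactly, which is
-- the statement that the half-turn maps the complement of B_λ × 1 onto B_λ′.
module Submission where

open import Defs
open import Data.Nat.ListAction using (sum)
open import Data.Nat as ℕ using (ℕ; zero; suc; _+_; _∸_; _<_; _≤_; _≥_; _≤?_; z≤n; s≤s)
import Data.Nat.Properties as ℕP
open import Data.Integer as ℤ using (ℤ; +_; -_)
import Data.Integer.Properties as ℤP
open import Data.Integer.Tactic.RingSolver using (solve-∀)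
open import Data.Fin using (Fin; toℕ; opposite)
open import Data.Fin.Properties using (toℕ<n; opposite-prop)
open import Data.List using (List; []; _∷_; map; reverse; _++_; [_]; length; filter; upTo; applyUpTo)
open import Data.List.Properties
  using (reverse-involutive; unfold-reverse; length-reverse; length-++; length-map; length-upTo; map-upTo; map-++; map-∘; map-cong; filter-none; filter-accept; filter-reject)
open import Data.List.Relation.Unary.All as All using (All; []; _∷_)
open import Data.List.Relation.Unary.AllPairs as AllPairs using (AllPairs; []; _∷_)
import Data.List.Relation.Unary.AllPairs.Properties as AllPairsP
open import Data.List.Relation.Unary.Linked as Linked using (Linked)
open import Data.List.Relation.Unary.Linked.Properties using (Linked⇒All)
open import Data.List.Relation.Unary.Sorted.TotalOrder.Properties using (↗↭↗⇒≋; AllPairs⇒Sorted; Sorted⇒AllPairs)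
open import Data.List.Relation.Binary.Pointwise using (Pointwise-≡⇒≡)
open import Data.List.Relation.Binary.Permutation.Propositional using (_↭_; ↭-trans; ↭-sym; ↭⇒↭ₛ; module PermutationReasoning)
open import Data.List.Relation.Binary.Permutation.Propositional.Properties
  using (↭-reverse; All-resp-↭; ↭-length)
  renaming (map⁺ to ↭-map⁺)
open import Data.List.Relation.Binary.BagAndSetEquality using (∼bag⇒↭)
open import Data.List.Membership.Propositional using (_∈_)
open import Data.List.Membership.Propositional.Properties
  using (∈-map⁺; ∈-map⁻; ∈-++⁺ˡ; ∈-++⁺ʳ; ∈-++⁻; ∈-upTo⁺; ∈-upTo⁻)
open import Data.List.Membership.Propositional.Properties.WithK using (unique∧set⇒bag)
open import Data.List.Relation.Unary.Unique.Propositional using (Unique)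
import Data.List.Relation.Unary.Unique.Propositional.Properties as UniqueP
import Data.List.Sort ℤP.≤-decTotalOrder as ZSort
open import Data.Product using (∃₂; _×_; _,_; swap)
open import Data.Sum using (inj₁; inj₂)
open import Function using (_∘_; flip; _⇔_; mk⇔; Equivalence)
open import Relation.Binary.Core using (Rel)
open import Relation.Nullary using (¬_; contradiction)
open import Relation.Binary.PropositionalEquality
  using (_≡_; refl; sym; trans; cong; cong₂; subst; subst₂; module ≡-Reasoning)

open Equivalence using (to; from)

AllPairs-reverse : ∀ {a ℓ} {A : Set a} {R : Rel A ℓ} {xs : List A} →
                   AllPairs R xs → AllPairs (flip R) (reverse xs)
AllPairs-reverse [] = []
AllPairs-reverse {xs = x ∷ xs} (px ∷ pxs) rewrite unfold-reverse x xs =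
  AllPairsP.++⁺ (AllPairs-reverse pxs) ([] ∷ [])
    (All.map (_∷ []) (All-resp-↭ (↭-sym (↭-reverse xs)) px))

reverse-sort-↭-map-neg : ∀ {xs ys} → ys ↭ map -_ xs → reverse (ZSort.sort ys) ≡ map -_ (ZSort.sort xs)
reverse-sort-↭-map-neg {xs} {ys} ys↭-xs = begin
  reverse (ZSort.sort ys)                      ≡⟨ cong reverse sort-ys ⟩
  reverse (reverse (map -_ (ZSort.sort xs)))   ≡⟨ reverse-involutive _ ⟩
  map -_ (ZSort.sort xs)                       ∎
  where
  open ≡-Reasoning
  candidate : List ℤ
  candidate = reverse (map -_ (ZSort.sort xs))
  candidate-↗ : Linked ℤ._≤_ candidate
  candidate-↗ = AllPairs⇒Sorted ℤP.≤-totalOrder (AllPairs-reverse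
    (AllPairsP.map⁺ (AllPairs.map ℤP.neg-mono-≤ (Sorted⇒AllPairs ℤP.≤-totalOrder (ZSort.sort-↗ xs)))))
  sort-ys↭candidate : ZSort.sort ys ↭ candidate
  sort-ys↭candidate = ↭-trans (ZSort.sort-↭ ys) (↭-trans ys↭-xs
    (↭-trans (↭-map⁺ -_ (↭-sym (ZSort.sort-↭ xs))) (↭-sym (↭-reverse _))))
  sort-ys : ZSort.sort ys ≡ candidate
  sort-ys = Pointwise-≡⇒≡ (↗↭↗⇒≋ ℤP.≤-totalOrder (ZSort.sort-↗ ys) candidate-↗ (↭⇒↭ₛ sort-ys↭candidate))

nth-map-neg : ∀ xs k → nth (map -_ xs) k ≡ - nth xs k
nth-map-neg []       k       = refl
nth-map-neg (x ∷ xs) zero    = refl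
nth-map-neg (x ∷ xs) (suc k) = nth-map-neg xs k

nth-++ˡ : ∀ xs ys {k} → k < length xs → nth (xs ++ ys) k ≡ nth xs k
nth-++ˡ (x ∷ xs) ys {zero}  _         = refl
nth-++ˡ (x ∷ xs) ys {suc k} (s≤s k<∣xs∣) = nth-++ˡ xs ys k<∣xs∣

nth-++-length : ∀ xs {y} ys → nth (xs ++ y ∷ ys) (length xs) ≡ y
nth-++-length []       ys = refl
nth-++-length (x ∷ xs) ys = nth-++-length xs ys

nth-reverse : ∀ xs k m → suc (k + m) ≡ length xs → nth (reverse xs) k ≡ nth xs m
nth-reverse (x ∷ xs) k zero    k+1≡ rewrite unfold-reverse x xs =
  subst (λ i → nth (reverse xs ++ [ x ]) i ≡ x)
        (trans (length-reverse xs) (trans (sym (ℕP.suc-injective k+1≡)) (ℕP.+-identityʳ k)))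
        (nth-++-length (reverse xs) [])
nth-reverse (x ∷ xs) k (suc m) k+m+2≡ rewrite unfold-reverse x xs =
  trans (nth-++ˡ (reverse xs) [ x ] (subst (k <_) (sym (length-reverse xs)) k<∣xs∣))
        (nth-reverse xs k m k+m+1≡)
  where
  k+m+1≡ : suc (k + m) ≡ length xs
  k+m+1≡ = trans (sym (ℕP.+-suc k m)) (ℕP.suc-injective k+m+2≡)
  k<∣xs∣ : k < length xs
  k<∣xs∣ = subst (k <_) k+m+1≡ (s≤s (ℕP.m≤m+n k m))

toℕ-+-toℕ-opposite : ∀ {n} (i : Fin n) → suc (toℕ i + toℕ (opposite i)) ≡ n
toℕ-+-toℕ-opposite {n} i = begin
  suc (toℕ i + toℕ (opposite i))  ≡⟨ cong (λ m → suc (toℕ i + m)) (opposite-prop i) ⟩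
  suc (toℕ i) + (n ∸ suc (toℕ i))  ≡⟨ ℕP.m+[n∸m]≡n (toℕ<n i) ⟩
  n                                ∎
  where open ≡-Reasoning

cellsFrom : ℕ → List ℕ → List (ℕ × ℕ)
cellsFrom j []       = []
cellsFrom j (r ∷ rs) = map (λ i → suc i , j) (upTo r) ++ cellsFrom (suc j) rs

content : ℕ × ℕ → ℤ
content (a , b) = + a ℤ.- + b

contentsFrom≡map-content : ∀ j l → contentsFrom j l ≡ map content (cellsFrom j l)
contentsFrom≡map-content j []       = refl
contentsFrom≡map-content j (r ∷ rs) = begin
  map (λ i → + suc i ℤ.- + j) (upTo r) ++ contentsFrom (suc j) rs
    ≡⟨ cong₂ _++_ (map-∘ (upTo r)) (contentsFrom≡map-content (suc j) rs) ⟩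
  map content (map (λ i → suc i , j) (upTo r)) ++ map content (cellsFrom (suc j) rs)
    ≡⟨ map-++ content (map (λ i → suc i , j) (upTo r)) (cellsFrom (suc j) rs) ⟨
  map content (cellsFrom j (r ∷ rs))
    ∎
  where open ≡-Reasoning

length-contentsFrom : ∀ j l → length (contentsFrom j l) ≡ sum l
length-contentsFrom j []       = refl
length-contentsFrom j (r ∷ rs) = begin
  length (map (λ i → + suc i ℤ.- + j) (upTo r) ++ contentsFrom (suc j) rs)
    ≡⟨ length-++ (map (λ i → + suc i ℤ.- + j) (upTo r)) ⟩
  length (map (λ i → + suc i ℤ.- + j) (upTo r)) + length (contentsFrom (suc j) rs)
    ≡⟨ cong₂ _+_ (trans (length-map _ (upTo r)) (length-upTo r)) (length-contentsFrom (suc j) rs) ⟩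
  r + sum rs
    ∎
  where open ≡-Reasoning

part : List ℕ → ℕ → ℕ
part []       _       = 0
part (x ∷ _)  zero    = x
part (_ ∷ xs) (suc k) = part xs k

InShape : ℕ → List ℕ → ℕ × ℕ → Set
InShape j l (a , b) = ∃₂ λ i k → a ≡ suc i × b ≡ j + k × i < part l k

∈-cellsFrom⁻ : ∀ j l {c} → c ∈ cellsFrom j l → InShape j l c
∈-cellsFrom⁻ j (r ∷ rs) c∈ with ∈-++⁻ (map (λ i → suc i , j) (upTo r)) c∈
... | inj₁ c∈row with ∈-map⁻ (λ i → suc i , j) c∈row
...   | i , i∈ , refl = i , 0 , refl , sym (ℕP.+-identityʳ j) , ∈-upTo⁻ i∈
∈-cellsFrom⁻ j (r ∷ rs) c∈ | inj₂ c∈rest with ∈-cellsFrom⁻ (suc j) rs c∈rest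
... | i , k , a≡ , b≡ , i<λₖ = i , suc k , a≡ , trans b≡ (sym (ℕP.+-suc j k)) , i<λₖ

∈-cellsFrom⁺ : ∀ j l {a b} → InShape j l (a , b) → (a , b) ∈ cellsFrom j l
∈-cellsFrom⁺ j (r ∷ rs) (i , zero , refl , refl , i<r) =
  subst (λ b → (suc i , b) ∈ cellsFrom j (r ∷ rs)) (sym (ℕP.+-identityʳ j))
    (∈-++⁺ˡ (∈-map⁺ (λ i → suc i , j) (∈-upTo⁺ i<r)))
∈-cellsFrom⁺ j (r ∷ rs) (i , suc k , a≡ , b≡ , i<λₖ) =
  ∈-++⁺ʳ (map (λ i → suc i , j) (upTo r))
    (∈-cellsFrom⁺ (suc j) rs (i , k , a≡ , trans b≡ (ℕP.+-suc j k) , i<λₖ))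

cellsFrom-unique : ∀ j l → Unique (cellsFrom j l)
cellsFrom-unique j []       = []
cellsFrom-unique j (r ∷ rs) =
  UniqueP.++⁺ (UniqueP.map⁺ suc-injective₁ (UniqueP.upTo⁺ r)) (cellsFrom-unique (suc j) rs) disjoint
  where
  suc-injective₁ : ∀ {x y} → (suc x , j) ≡ (suc y , j) → x ≡ y
  suc-injective₁ refl = refl
  disjoint : ∀ {c} → ¬ (c ∈ map (λ i → suc i , j) (upTo r) × c ∈ cellsFrom (suc j) rs)
  disjoint (c∈row , c∈rest) with ∈-map⁻ (λ i → suc i , j) c∈row
  ... | _ , _ , refl with ∈-cellsFrom⁻ (suc j) rs c∈rest
  ...   | _ , k , _ , j≡ , _ = ℕP.m+1+n≢m j (trans (ℕP.+-suc j k) (sym j≡))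

partsAbove : ℕ → List ℕ → ℕ
partsAbove k l = length (filter (λ m → suc k ≤? m) l)

part-≤ : ∀ {m l} → All (_≤ m) l → ∀ k → part l k ≤ m
part-≤ []       k       = z≤n
part-≤ (p ∷ _)  zero    = p
part-≤ (_ ∷ ps) (suc k) = part-≤ ps k

head-≥-parts : ∀ {x xs} → Linked _≥_ (x ∷ xs) → All (_≤ x) (x ∷ xs)
head-≥-parts = Linked⇒All (flip ℕP.≤-trans) ℕP.≤-refl

<-partsAbove⇔ : ∀ {l} → Linked _≥_ l → ∀ i k → i < partsAbove k l ⇔ k < part l i
<-partsAbove⇔ {[]} _ i k = mk⇔ (λ ()) (λ ())
<-partsAbove⇔ {x ∷ xs} λ↘ i k with ℕP.≤-<-connex x k
... | inj₂ k<x =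
  subst (λ p → i < p ⇔ k < part (x ∷ xs) i)
        (sym (cong length (filter-accept (λ m → suc k ≤? m) k<x))) (below-head i)
  where
  below-head : ∀ i → i < suc (partsAbove k xs) ⇔ k < part (x ∷ xs) i
  below-head zero    = mk⇔ (λ _ → k<x) (λ _ → s≤s z≤n)
  below-head (suc i) = mk⇔ (to IH ∘ ℕP.≤-pred) (s≤s ∘ from IH)
    where
    IH : i < partsAbove k xs ⇔ k < part xs i
    IH = <-partsAbove⇔ (Linked.tail λ↘) i k
... | inj₁ x≤k =
  subst (λ p → i < p ⇔ k < part (x ∷ xs) i)
        (sym (cong length (filter-reject (λ m → suc k ≤? m) (ℕP.≤⇒≯ x≤k))))
        (mk⇔ (λ i<p → contradiction i<p (no-part-above i)) (λ k<λᵢ → contradiction k<λᵢ (ℕP.≤⇒≯ λᵢ≤k)))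
  where
  λᵢ≤k : part (x ∷ xs) i ≤ k
  λᵢ≤k = ℕP.≤-trans (part-≤ (head-≥-parts λ↘) i) x≤k
  no-part-above : ∀ i → ¬ (i < partsAbove k xs)
  no-part-above i = subst (λ p → ¬ (i < p))
    (sym (cong length (filter-none (λ m → suc k ≤? m) (All.map (λ y≤x → ℕP.≤⇒≯ (ℕP.≤-trans y≤x x≤k))
                                                         (All.tail (head-≥-parts λ↘))))))
    ℕP.n≮0

part-applyUpTo : ∀ (f : ℕ → ℕ) {h k} → k < h → part (applyUpTo f h) k ≡ f k
part-applyUpTo f {suc h} {zero}  _         = refl
part-applyUpTo f {suc h} {suc k} (s≤s k<h) = part-applyUpTo (f ∘ suc) k<h

part-applyUpTo-≥ : ∀ (f : ℕ → ℕ) {h k} → h ≤ k → part (applyUpTo f h) k ≡ 0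
part-applyUpTo-≥ f {zero}  {k}     _         = refl
part-applyUpTo-≥ f {suc h} {suc k} (s≤s h≤k) = part-applyUpTo-≥ (f ∘ suc) h≤k

part-conjugateParts : ∀ {l} → Linked _≥_ l → ∀ k → part (conjugateParts l) k ≡ partsAbove k l
part-conjugateParts {[]}     _  k = refl
part-conjugateParts {x ∷ xs} λ↘ k with ℕP.≤-<-connex x k
... | inj₂ k<x = trans (cong (λ p → part p k) (map-upTo _ x)) (part-applyUpTo _ k<x)
... | inj₁ x≤k = trans (cong (λ p → part p k) (map-upTo _ x))
  -- a part of λ above k would give k < λ₁ = x
  (trans (part-applyUpTo-≥ _ x≤k)
         (sym (ℕP.n≤0⇒n≡0 (ℕP.≮⇒≥ (ℕP.≤⇒≯ x≤k ∘ to (<-partsAbove⇔ λ↘ 0 k))))))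

InShape-conjugate⇔ : ∀ {l} → Linked _≥_ l → ∀ {a b} → InShape 1 (conjugateParts l) (a , b) ⇔ InShape 1 l (b , a)
InShape-conjugate⇔ λ↘ = mk⇔
  (λ { (i , k , a≡ , b≡ , i<λ′ₖ) →
         k , i , b≡ , a≡ , to (<-partsAbove⇔ λ↘ i k) (subst (i <_) (part-conjugateParts λ↘ k) i<λ′ₖ) })
  (λ { (k , i , b≡ , a≡ , k<λᵢ) →
         i , k , a≡ , b≡ , subst (i <_) (sym (part-conjugateParts λ↘ k)) (from (<-partsAbove⇔ λ↘ i k) k<λᵢ) })

cells-conjugate↭map-swap : ∀ {l} → Linked _≥_ l → cellsFrom 1 (conjugateParts l) ↭ map swap (cellsFrom 1 l)
cells-conjugate↭map-swap {l} λ↘ = ∼bag⇒↭ (unique∧set⇒bag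
  (cellsFrom-unique 1 (conjugateParts l)) (UniqueP.map⁺ swap-injective (cellsFrom-unique 1 l))
  (mk⇔ transpose untranspose))
  where
  swap-injective : ∀ {c d : ℕ × ℕ} → swap c ≡ swap d → c ≡ d
  swap-injective {_ , _} {_ , _} refl = refl
  transpose : ∀ {c} → c ∈ cellsFrom 1 (conjugateParts l) → c ∈ map swap (cellsFrom 1 l)
  transpose c∈ =
    ∈-map⁺ swap (∈-cellsFrom⁺ 1 l (to (InShape-conjugate⇔ λ↘) (∈-cellsFrom⁻ 1 (conjugateParts l) c∈)))
  untranspose : ∀ {c} → c ∈ map swap (cellsFrom 1 l) → c ∈ cellsFrom 1 (conjugateParts l)
  untranspose c∈ with ∈-map⁻ swap c∈
  ... | (b , a) , ba∈ , refl =
    ∈-cellsFrom⁺ 1 (conjugateParts l) (from (InShape-conjugate⇔ λ↘) (∈-cellsFrom⁻ 1 l ba∈))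

content-swap : ∀ c → content (swap c) ≡ - content c
content-swap (a , b) = neg-difference (+ a) (+ b)
  where
  neg-difference : ∀ (x y : ℤ) → y ℤ.- x ≡ - (x ℤ.- y)
  neg-difference = solve-∀

contents-conjugate↭map-neg : ∀ {l} → Linked _≥_ l → contents (conjugateParts l) ↭ map -_ (contents l)
contents-conjugate↭map-neg {l} λ↘ = begin
  contents (conjugateParts l)               ≡⟨ contentsFrom≡map-content 1 (conjugateParts l) ⟩
  map content (cellsFrom 1 (conjugateParts l)) ↭⟨ ↭-map⁺ content (cells-conjugate↭map-swap λ↘) ⟩
  map content (map swap (cellsFrom 1 l))     ≡⟨ map-∘ (cellsFrom 1 l) ⟨
  map (content ∘ swap) (cellsFrom 1 l)       ≡⟨ map-cong content-swap (cellsFrom 1 l) ⟩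
  map (-_ ∘ content) (cellsFrom 1 l)         ≡⟨ map-∘ (cellsFrom 1 l) ⟩
  map -_ (map content (cellsFrom 1 l))       ≡⟨ cong (map -_) (contentsFrom≡map-content 1 l) ⟨
  map -_ (contents l)                        ∎
  where open PermutationReasoning

sortedContents-conjugate : ∀ {l} → Linked _≥_ l → sortedContents (conjugateParts l) ≡ map -_ (ZSort.sort (contents l))
sortedContents-conjugate λ↘ = reverse-sort-↭-map-neg (contents-conjugate↭map-neg λ↘)

¬suc≤⇔suc≤ : ∀ {a b : ℤ} {x y : ℕ} → a ℤ.+ b ≡ + suc (x + y) → (¬ (+ suc x ℤ.≤ a)) ⇔ (+ suc y ℤ.≤ b)
¬suc≤⇔suc≤ {a} {b} {x} {y} a+b≡ = mk⇔ above below
  where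
  total≡ : + suc (x + y) ≡ + x ℤ.+ + suc y
  total≡ = trans (cong +_ (sym (ℕP.+-suc x y))) (ℤP.pos-+ x (suc y))
  cancel : ∀ (u v : ℤ) → (u ℤ.+ v) ℤ.- u ≡ v
  cancel = solve-∀
  above : ¬ (+ suc x ℤ.≤ a) → + suc y ℤ.≤ b
  above a≰x = begin
    + suc y                     ≡⟨ cancel (+ x) (+ suc y) ⟨
    (+ x ℤ.+ + suc y) ℤ.- + x   ≤⟨ ℤP.+-monoʳ-≤ (+ x ℤ.+ + suc y) (ℤP.neg-mono-≤ a≤x) ⟩
    (+ x ℤ.+ + suc y) ℤ.- a     ≡⟨ cong (ℤ._- a) (trans (sym total≡) (sym a+b≡)) ⟩
    (a ℤ.+ b) ℤ.- a             ≡⟨ cancel a b ⟩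
    b                           ∎
    where
    open ℤP.≤-Reasoning
    a≤x : a ℤ.≤ + x
    a≤x = ℤP.≮⇒≥ (a≰x ∘ ℤP.i<j⇒suc[i]≤j)
  below : + suc y ℤ.≤ b → ¬ (+ suc x ℤ.≤ a)
  below suc-y≤b suc-x≤a = ℕP.n≮n (x + y) (ℕP.≤-pred (subst (ℕ._≤ suc (x + y)) (cong suc (ℕP.+-suc x y))
    (ℤP.drop‿+≤+ (subst₂ ℤ._≤_ (sym (ℤP.pos-+ (suc x) (suc y))) a+b≡ (ℤP.+-mono-≤ suc-x≤a suc-y≤b)))))

complement-ferrersBoard-rot180 : ∀ {n} (h h′ : ℕ → ℤ) →
  (∀ (i : Fin n) → h (suc (toℕ i)) ℤ.+ h′ (suc (toℕ (opposite i))) ≡ + n) →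
  complement (ferrersBoard n h) ≅rot ferrersBoard n h′
complement-ferrersBoard-rot180 {n} h h′ columns-fill =
  rot180 , (λ i j → to (cut i j)) , (λ i j → from (cut i j))
  where
  cut : ∀ i j → (¬ ferrersBoard n h i j) ⇔ ferrersBoard n h′ (opposite i) (opposite j)
  cut i j = ¬suc≤⇔suc≤ (trans (columns-fill i) (cong +_ (sym (toℕ-+-toℕ-opposite j))))

heightB×1-+-heightB-conjugate : ∀ {n} (lam : Partition n) (i : Fin n) →
  (heightB (parts lam) (suc (toℕ i)) ℤ.+ + 1) ℤ.+ heightB (conjugateParts (parts lam)) (suc (toℕ (opposite i))) ≡ + n
heightB×1-+-heightB-conjugate {n} lam i = begin
  (nth (reverse S) (toℕ i) ℤ.+ + toℕ i ℤ.+ + 1) ℤ.+ (nth (sortedContents (conjugateParts l)) i′ ℤ.+ + i′)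
    ≡⟨ cong₂ (λ c c′ → (c ℤ.+ + toℕ i ℤ.+ + 1) ℤ.+ (c′ ℤ.+ + i′))
             (nth-reverse S (toℕ i) i′ (trans (toℕ-+-toℕ-opposite i) (sym length-S)))
             (trans (cong (λ cs → nth cs i′) (sortedContents-conjugate (weaklyDecreasing lam))) (nth-map-neg S i′)) ⟩
  (nth S i′ ℤ.+ + toℕ i ℤ.+ + 1) ℤ.+ (- nth S i′ ℤ.+ + i′)
    ≡⟨ contents-cancel (nth S i′) (+ toℕ i) (+ i′) ⟩
  + 1 ℤ.+ (+ toℕ i ℤ.+ + i′)
    ≡⟨ cong (λ m → + 1 ℤ.+ m) (ℤP.pos-+ (toℕ i) i′) ⟨
  + suc (toℕ i + i′)
    ≡⟨ cong +_ (toℕ-+-toℕ-opposite i) ⟩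
  + n
    ∎
  where
  open ≡-Reasoning
  l : List ℕ
  l = parts lam
  S : List ℤ
  S = ZSort.sort (contents l)
  i′ : ℕ
  i′ = toℕ (opposite i)
  length-S : length S ≡ n
  length-S = trans (↭-length (ZSort.sort-↭ (contents l))) (trans (length-contentsFrom 1 l) (sumIsN lam))
  contents-cancel : ∀ (c u v : ℤ) → (c ℤ.+ u ℤ.+ + 1) ℤ.+ (- c ℤ.+ v) ≡ + 1 ℤ.+ (u ℤ.+ v)
  contents-cancel = solve-∀

mainTheorem1 : (n : ℕ) (lam : Partition n) → complement (B×1 lam) ≅rot Bconj lam
mainTheorem1 n lam =
  complement-ferrersBoard-rot180 (λ i → heightB (parts lam) i ℤ.+ + 1) (heightB (conjugateParts (parts lam)))
    (heightB×1-+-heightB-conjugate lam)
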